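{- Let $A=\{x_1,\ldots,x_m\}$ be a finite alphabet and let $n\geq 1$. There is an integer $C(m,n)$ with the following property. Every word $s$ over $A$ with $|s|\geq C(m,n)$ contains a non-empty subword $w$ such that, for every non-empty word $w'$ over $A$ of length at most $n$, the number $\#(w,w')$ is even.
   Context: A word over $A$ is a finite sequence of elements of $A$. For a word $w$, write $|w|$ for its length and $w(i)$ for its $i$-th symbol, indexed from $0$. A subword of $w$ is a contiguous block $w(i)w(i+1)\cdots w(j)$ of $w$. For words $w$ and $w'$, the number $\#(w,w')$ is the number of tuples $(x_0,\ldots,x_{|w'|-1})$ of integers with $0\le x_0<x_1<\cdots<x_{|w'|-1}<|w|$ and $w(x_i)=w'(i)$ for all $i$. In other words, it is the number of ways in which $w'$ occurs as a (not necessarily contiguous) subsequence of $w$. -}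

module Defs where

open import Data.Nat using (ℕ; zero; suc; _+_)
open import Data.Fin using (Fin; _≟_)
open import Data.List using (List; []; _∷_)
open import Relation.Nullary using (yes; no)

-- #(w , w') : number of ways w' occurs as a (not necessarily contiguous)
-- subsequence of w, i.e. the number of index tuples x₀ < … < x_{k-1} < |w|
-- with w(xᵢ) = w'(i).
occ : {m : ℕ} → List (Fin m) → List (Fin m) → ℕ
occ w       []        = 1
occ []      (_ ∷ _)   = 0
occ (a ∷ w) (b ∷ w') with a ≟ b
... | yes _ = occ w (b ∷ w') + occ w w'
... | no  _ = occ w (b ∷ w')

-- Colour each prefix of s by the parities of #(prefix, w') for the finitely
-- many w' with |w'| ≤ n. Once |s| ≥ 2^(number of such w'), two prefixes u and
-- u w get the same colour. Since #(u w, ·) = #(u, ·) ⋆ #(w, ·) is a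
-- convolution over the factorisations of the pattern, equality of the
-- colours forces, by induction on |w'|, every #(w, w') with 0 < |w'| ≤ n to be
-- even.
module Submission where

open import Defs
open import Data.Nat using (ℕ; _≤_; _≥_; suc)
open import Data.Nat.Divisibility using (_∣_)
open import Data.Fin using (Fin)
open import Data.List using (List; []; _∷_; _++_; length)
open import Data.Product using (Σ; _×_; ∃; ∃-syntax)
open import Relation.Binary.PropositionalEquality using (_≡_; _≢_)

open import Algebra.Properties.CommutativeSemigroup using (interchange)
open import Data.Empty using (⊥-elim)
open import Data.Fin using (zero; suc; toℕ; funToFin; finToFun; _≟_)
open import Data.Fin.Properties using (pigeonhole; toℕ<n; finToFun-funToFin)
open import Data.List using (take; drop; lookup; map; concatMap; allFin)
open import Data.List.Properties using (take++drop≡id)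
open import Data.List.Membership.Propositional using (_∈_)
open import Data.List.Membership.Propositional.Properties using (∈-map⁺; ∈-concatMap⁺; ∈-allFin)
open import Data.List.Relation.Unary.Any as Any using (here; there)
open import Data.List.Relation.Unary.Any.Properties using (lookup-index)
open import Data.Nat using (zero; suc; _+_; _*_; _^_; parity; s≤s⁻¹)
open import Data.Nat.Divisibility using (_∣0; ∣-refl; ∣m∣n⇒∣m+n)
open import Data.Nat.Properties
  using (+-assoc; +-identityʳ; *-identityˡ; *-distribʳ-+; +-commutativeSemigroup; ≤-trans; <⇒≤; m≤n⇒m≤1+n; n<1+n)
open import Data.Parity as ℙ using (Parity; 0ℙ; 1ℙ)
import Data.Parity.Properties as ℙₚ
open import Data.Product using (_,_)
open import Function using (_∘_)
open import Relation.Binary.PropositionalEquality using (refl; sym; trans; cong; cong₂; subst; _≗_; module ≡-Reasoning)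
open import Relation.Nullary using (yes; no)

parity≡0ℙ⇒2∣ : ∀ k → parity k ≡ 0ℙ → 2 ∣ k
parity≡0ℙ⇒2∣ zero          _ = 2 ∣0
parity≡0ℙ⇒2∣ (suc (suc k)) p = ∣m∣n⇒∣m+n (∣-refl {2}) (parity≡0ℙ⇒2∣ k p)

parityToFin : Parity → Fin 2
parityToFin 0ℙ = zero
parityToFin 1ℙ = suc zero

parityToFin-injective : ∀ {p q} → parityToFin p ≡ parityToFin q → p ≡ q
parityToFin-injective {0ℙ} {0ℙ} _ = refl
parityToFin-injective {1ℙ} {1ℙ} _ = refl

funToFin-injective : ∀ {k n} {f g : Fin k → Fin n} → funToFin f ≡ funToFin g → f ≗ g
funToFin-injective {f = f} {g} eq i = begin
  f i                       ≡⟨ finToFun-funToFin f i ⟨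
  finToFun (funToFin f) i   ≡⟨ cong (λ c → finToFun c i) eq ⟩
  finToFun (funToFin g) i   ≡⟨ finToFun-funToFin g i ⟩
  g i                       ∎
  where open ≡-Reasoning

module _ {a} {A : Set a} where

  splitBetween : ∀ i j (s : List A) → suc i ≤ j → j ≤ length s →
    ∃[ u ] ∃[ w ] ∃[ v ] (s ≡ u ++ w ++ v × w ≢ [] × take i s ≡ u × take j s ≡ u ++ w)
  splitBetween zero    (suc j) (x ∷ s) _ _ =
    [] , take (suc j) (x ∷ s) , drop (suc j) (x ∷ s) , sym (take++drop≡id (suc j) (x ∷ s)) , (λ ()) , refl , refl
  splitBetween (suc i) (suc j) (x ∷ s) i<j j≤ℓ
    with u , w , v , s≡ , w≢[] , tᵢ , tⱼ ← splitBetween i j s (s≤s⁻¹ i<j) (s≤s⁻¹ j≤ℓ) =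
    x ∷ u , w , v , cong (x ∷_) s≡ , w≢[] , cong (x ∷_) tᵢ , cong (x ∷_) tⱼ

  prefixes-collide : ∀ {k} (c : List A → Fin k) (s : List A) → k ≤ length s →
    ∃[ u ] ∃[ w ] ∃[ v ] (s ≡ u ++ w ++ v × w ≢ [] × c u ≡ c (u ++ w))
  prefixes-collide {k} c s k≤ℓ
    with i , j , i<j , cᵢ≡cⱼ ← pigeonhole (n<1+n k) (λ i → c (take (toℕ i) s))
    with u , w , v , s≡ , w≢[] , tᵢ , tⱼ ← splitBetween (toℕ i) (toℕ j) s i<j (≤-trans (s≤s⁻¹ (toℕ<n j)) k≤ℓ) =
    u , w , v , s≡ , w≢[] , trans (cong c (sym tᵢ)) (trans cᵢ≡cⱼ (cong c tⱼ))

  -- (f ⋆ g) t = Σ over all factorisations t = p ++ q of f p * g q.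
  infixl 7 _⋆_
  _⋆_ : (List A → ℕ) → (List A → ℕ) → List A → ℕ
  (f ⋆ g) []      = f [] * g []
  (f ⋆ g) (b ∷ t) = f [] * g (b ∷ t) + (f ∘ (b ∷_) ⋆ g) t

  ⋆-zeroˡ : ∀ g t → ((λ _ → 0) ⋆ g) t ≡ 0
  ⋆-zeroˡ g []      = refl
  ⋆-zeroˡ g (b ∷ t) = ⋆-zeroˡ g t

  ⋆-distribʳ-+ : ∀ f f′ g t → ((λ p → f p + f′ p) ⋆ g) t ≡ (f ⋆ g) t + (f′ ⋆ g) t
  ⋆-distribʳ-+ f f′ g []      = *-distribʳ-+ (g []) (f []) (f′ [])
  ⋆-distribʳ-+ f f′ g (b ∷ t) = begin
    (f [] + f′ []) * g (b ∷ t) + ((λ p → f (b ∷ p) + f′ (b ∷ p)) ⋆ g) t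
      ≡⟨ cong₂ _+_ (*-distribʳ-+ (g (b ∷ t)) (f []) (f′ [])) (⋆-distribʳ-+ (f ∘ (b ∷_)) (f′ ∘ (b ∷_)) g t) ⟩
    (f [] * g (b ∷ t) + f′ [] * g (b ∷ t)) + ((f ∘ (b ∷_) ⋆ g) t + (f′ ∘ (b ∷_) ⋆ g) t)
      ≡⟨ interchange +-commutativeSemigroup (f [] * g (b ∷ t)) _ ((f ∘ (b ∷_) ⋆ g) t) _ ⟩
    (f ⋆ g) (b ∷ t) + (f′ ⋆ g) (b ∷ t) ∎
    where open ≡-Reasoning

  ⋆-parity-unitʳ : ∀ k (f g : List A → ℕ) → parity (g []) ≡ 1ℙ →
    (∀ b q → length (b ∷ q) ≤ k → parity (g (b ∷ q)) ≡ 0ℙ) →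
    ∀ t → length t ≤ k → parity ((f ⋆ g) t) ≡ parity (f t)
  ⋆-parity-unitʳ k f g g[]-odd g-even [] _ = begin
    parity (f [] * g [])            ≡⟨ ℙₚ.*-homo-* (f []) (g []) ⟩
    parity (f []) ℙ.* parity (g []) ≡⟨ cong (parity (f []) ℙ.*_) g[]-odd ⟩
    parity (f []) ℙ.* 1ℙ            ≡⟨ ℙₚ.*-identityʳ (parity (f [])) ⟩
    parity (f [])                   ∎
    where open ≡-Reasoning
  ⋆-parity-unitʳ k f g g[]-odd g-even (b ∷ t) bt≤k = begin
    parity (f [] * g (b ∷ t) + (f ∘ (b ∷_) ⋆ g) t)
      ≡⟨ ℙₚ.+-homo-+ (f [] * g (b ∷ t)) _ ⟩
    parity (f [] * g (b ∷ t)) ℙ.+ parity ((f ∘ (b ∷_) ⋆ g) t)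
      ≡⟨ cong₂ ℙ._+_ (ℙₚ.*-homo-* (f []) (g (b ∷ t)))
                     (⋆-parity-unitʳ k (f ∘ (b ∷_)) g g[]-odd g-even t (<⇒≤ bt≤k)) ⟩
    parity (f []) ℙ.* parity (g (b ∷ t)) ℙ.+ parity (f (b ∷ t))
      ≡⟨ cong (λ p → parity (f []) ℙ.* p ℙ.+ parity (f (b ∷ t))) (g-even b t bt≤k) ⟩
    parity (f []) ℙ.* 0ℙ ℙ.+ parity (f (b ∷ t))
      ≡⟨ cong (ℙ._+ parity (f (b ∷ t))) (ℙₚ.*-zeroʳ (parity (f []))) ⟩
    parity (f (b ∷ t)) ∎
    where open ≡-Reasoning

module _ {m : ℕ} where

  occ-++ : ∀ (x y t : List (Fin m)) → occ (x ++ y) t ≡ (occ x ⋆ occ y) t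
  occ-++ []      y []      = refl
  occ-++ []      y (b ∷ t) = sym (begin
    1 * occ y (b ∷ t) + ((λ _ → 0) ⋆ occ y) t ≡⟨ cong₂ _+_ (*-identityˡ (occ y (b ∷ t))) (⋆-zeroˡ (occ y) t) ⟩
    occ y (b ∷ t) + 0                         ≡⟨ +-identityʳ (occ y (b ∷ t)) ⟩
    occ y (b ∷ t)                             ∎)
    where open ≡-Reasoning
  occ-++ (a ∷ x) y []      = refl
  occ-++ (a ∷ x) y (b ∷ t) with a ≟ b
  ... | no  _ = occ-++ x y (b ∷ t)
  ... | yes _ = begin
    occ (x ++ y) (b ∷ t) + occ (x ++ y) t
      ≡⟨ cong₂ _+_ (occ-++ x y (b ∷ t)) (occ-++ x y t) ⟩
    (1 * occ y (b ∷ t) + (occ x ∘ (b ∷_) ⋆ occ y) t) + (occ x ⋆ occ y) t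
      ≡⟨ +-assoc (1 * occ y (b ∷ t)) _ _ ⟩
    1 * occ y (b ∷ t) + ((occ x ∘ (b ∷_) ⋆ occ y) t + (occ x ⋆ occ y) t)
      ≡⟨ cong (1 * occ y (b ∷ t) +_) (⋆-distribʳ-+ (occ x ∘ (b ∷_)) (occ x) (occ y) t) ⟨
    1 * occ y (b ∷ t) + ((λ p → occ x (b ∷ p) + occ x p) ⋆ occ y) t ∎
    where open ≡-Reasoning

  occ-++-sameParity⇒even : ∀ k (u w : List (Fin m)) →
    (∀ t → length t ≤ k → parity (occ (u ++ w) t) ≡ parity (occ u t)) →
    ∀ b t → length (b ∷ t) ≤ k → parity (occ w (b ∷ t)) ≡ 0ℙ
  occ-++-sameParity⇒even (suc k) u w same b t bt≤k =
    ℙₚ.+-cancelʳ-≡ (parity (occ u (b ∷ t))) _ 0ℙ (begin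
      parity (occ w (b ∷ t)) ℙ.+ parity (occ u (b ∷ t))
        ≡⟨ cong₂ ℙ._+_ (cong parity (*-identityˡ (occ w (b ∷ t)))) (⋆-parity-unitʳ k _ (occ w) refl w-even t (s≤s⁻¹ bt≤k)) ⟨
      parity (1 * occ w (b ∷ t)) ℙ.+ parity ((occ u ∘ (b ∷_) ⋆ occ w) t)
        ≡⟨ ℙₚ.+-homo-+ (1 * occ w (b ∷ t)) _ ⟨
      parity ((occ u ⋆ occ w) (b ∷ t))
        ≡⟨ cong parity (occ-++ u w (b ∷ t)) ⟨
      parity (occ (u ++ w) (b ∷ t))
        ≡⟨ same (b ∷ t) bt≤k ⟩
      parity (occ u (b ∷ t)) ∎)
    where
    open ≡-Reasoning
    w-even : ∀ b q → length (b ∷ q) ≤ k → parity (occ w (b ∷ q)) ≡ 0ℙ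
    w-even = occ-++-sameParity⇒even k u w (λ t t≤k → same t (m≤n⇒m≤1+n t≤k))

  wordsUpTo : ℕ → List (List (Fin m))
  wordsUpTo zero    = [] ∷ []
  wordsUpTo (suc k) = [] ∷ concatMap (λ a → map (a ∷_) (wordsUpTo k)) (allFin m)

  ∈-wordsUpTo : ∀ k (t : List (Fin m)) → length t ≤ k → t ∈ wordsUpTo k
  ∈-wordsUpTo zero    []      _    = here refl
  ∈-wordsUpTo (suc k) []      _    = here refl
  ∈-wordsUpTo (suc k) (a ∷ t) at≤k = there (∈-concatMap⁺ (λ a → map (a ∷_) (wordsUpTo k))
    (Any.map (λ { refl → ∈-map⁺ (a ∷_) (∈-wordsUpTo k t (s≤s⁻¹ at≤k)) }) (∈-allFin a)))

  parityProfile : ∀ k → List (Fin m) → Fin (2 ^ length (wordsUpTo k))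
  parityProfile k x = funToFin (λ i → parityToFin (parity (occ x (lookup (wordsUpTo k) i))))

  parityProfile-≡ : ∀ k x y → parityProfile k x ≡ parityProfile k y →
    ∀ t → length t ≤ k → parity (occ x t) ≡ parity (occ y t)
  parityProfile-≡ k x y eq t t≤k = subst (λ t′ → parity (occ x t′) ≡ parity (occ y t′))
    (sym (lookup-index t∈)) (parityToFin-injective (funToFin-injective eq (Any.index t∈)))
    where t∈ = ∈-wordsUpTo k t t≤k

mainTheorem6 : (m n : ℕ) → 1 ≤ n →
    ∃[ C ] ((s : List (Fin m)) → length s ≥ C →
    ∃[ u ] ∃[ w ] ∃[ v ] (s ≡ u ++ w ++ v × w ≢ [] ×
    ((w' : List (Fin m)) → w' ≢ [] → length w' ≤ n → 2 ∣ occ w w')))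
mainTheorem6 m n _ = 2 ^ length (wordsUpTo {m} n) , factor
  where
  factor : (s : List (Fin m)) → length s ≥ 2 ^ length (wordsUpTo n) →
    ∃[ u ] ∃[ w ] ∃[ v ] (s ≡ u ++ w ++ v × w ≢ [] ×
    ((w' : List (Fin m)) → w' ≢ [] → length w' ≤ n → 2 ∣ occ w w'))
  factor s |s|≥C
    with u , w , v , s≡ , w≢[] , same ← prefixes-collide (parityProfile n) s |s|≥C =
    u , w , v , s≡ , w≢[] , w-even
    where
    w-even : (w' : List (Fin m)) → w' ≢ [] → length w' ≤ n → 2 ∣ occ w w'
    w-even []      w'≢[] _    = ⊥-elim (w'≢[] refl)
    w-even (b ∷ t) _     bt≤n = parity≡0ℙ⇒2∣ (occ w (b ∷ t))
      (occ-++-sameParity⇒even n u w (parityProfile-≡ n (u ++ w) u (sym same)) b t bt≤n)
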